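{- A poset has the relational fixed point property (RFPP) if and only if it has the convex fixed point property (CFPP) and contains no chain of the same order type as the integers $\mathbb{Z}$. In particular RFPP and CFPP coincide for finite posets.
   Context: For a poset $P$, let $\mathfrak{P}(P)$ be the set of nonempty subsets of $P$ with the bi-dominating preorder: $X\le Y$ iff every element of $X$ is below some element of $Y$ and every element of $Y$ is above some element of $X$. A map $f:P\to\mathfrak{P}(P)$ is order preserving if $x\le y$ implies $f(x)\le f(y)$; a fixed point is $x\in P$ with $x\in f(x)$. $P$ has RFPP if every order preserving $f:P\to\mathfrak{P}(P)$ has a fixed point. $\mathcal{C}(P)$ is the set of nonempty convex subsets of $P$ with the bi-dominating order; $P$ has CFPP if every order preserving $f:P\to\mathcal{C}(P)$ has a fixed point. -}

module Defs where

open import Level using (Level; _⊔_; suc)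
open import Data.Nat using (ℕ)
open import Data.Fin using (Fin)
open import Data.Integer as ℤ using (ℤ)
open import Data.Product using (Σ; ∃; _×_; _,_)
open import Relation.Binary.Bundles using (Poset)
open import Relation.Nullary using (¬_)

module _ {c ℓ₁ ℓ₂ : Level} (P : Poset c ℓ₁ ℓ₂) where
  open Poset P

  lvl : Level
  lvl = c ⊔ ℓ₁ ⊔ ℓ₂

  record Subset : Set (suc lvl) where
    field
      mem      : Carrier → Set lvl
      respects : ∀ {x y} → x ≈ y → mem x → mem y
  open Subset public

  Nonempty : Subset → Set lvl
  Nonempty X = ∃ λ x → mem X x

  Convex : Subset → Set lvl
  Convex X = ∀ {x y z} → mem X x → mem X z → x ≤ y → y ≤ z → mem X y

  _⊑_ : Subset → Subset → Set lvl
  X ⊑ Y = (∀ x → mem X x → ∃ λ y → mem Y y × x ≤ y)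
        × (∀ y → mem Y y → ∃ λ x → mem X x × x ≤ y)

  RFPP : Set (suc lvl)
  RFPP = (f : Carrier → Subset)
       → (∀ x → Nonempty (f x))
       → (∀ {x y} → x ≤ y → f x ⊑ f y)
       → ∃ λ x → mem (f x) x

  CFPP : Set (suc lvl)
  CFPP = (f : Carrier → Subset)
       → (∀ x → Nonempty (f x))
       → (∀ x → Convex (f x))
       → (∀ {x y} → x ≤ y → f x ⊑ f y)
       → ∃ λ x → mem (f x) x

  ℤChain : Set (c ⊔ ℓ₂)
  ℤChain = Σ (ℤ → Carrier) λ g →
             (∀ i j → i ℤ.≤ j → g i ≤ g j) × (∀ i j → g i ≤ g j → i ℤ.≤ j)

  Finite : Set (c ⊔ ℓ₁)
  Finite = Σ ℕ λ n → Σ (Fin n → Carrier) λ e → ∀ x → ∃ λ k → e k ≈ x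

-- If f has no fixed point, its pointwise convex hull still has one: a point x with
-- a ≤ x ≤ b for some a, b ∈ f x. Bi-domination lets us continue from b upwards and from
-- a downwards, each new point lying in the image of the previous one; since f has no
-- fixed point every step is strict, and the two sequences glue into a chain of type ℤ.
-- Conversely, sending x to the points of a ℤ-chain other than x is order preserving
-- because the chain is unbounded on both sides, and it has no fixed point.
-- Finite posets carry no ℤ-chain by pigeonhole.

module Submission where

open import Defs
open import Level using (Level; _⊔_; Lift; lift; lower)
open import Axiom.ExcludedMiddle using (ExcludedMiddle)
open import Data.Empty using (⊥-elim)
open import Data.Fin using (toℕ)
open import Data.Fin.Properties using (pigeonhole)
open import Data.Integer as ℤ using (ℤ; +_; -[1+_])
import Data.Integer.Properties as ℤ
open import Data.Nat as ℕ using (ℕ; zero; suc; _≤′_; ≤′-refl; ≤′-step)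
import Data.Nat.Properties as ℕ
open import Data.Product using (Σ; ∃; _×_; _,_; proj₁; proj₂; map₂; uncurry)
open import Data.Sum using (_⊎_; inj₁; inj₂; [_,_]′)
open import Function using (_∘_; flip)
open import Function.Bundles using (_⇔_; mk⇔)
open import Relation.Binary.Bundles using (Poset)
open import Relation.Binary.Core using (Rel)
import Relation.Binary.Construct.Flip.Ord as Flip
open import Relation.Binary.PropositionalEquality as ≡ using (_≡_; _≢_)
open import Relation.Nullary using (¬_; yes; no)
open import Relation.Nullary.Decidable using (map′)

module _ {a ℓ ℓ′} {A : Set a} (_≼_ : Rel A ℓ) (_↦_ : Rel A ℓ′)
         (extend : ∀ {y z} → y ≼ z → y ↦ z → ∃ λ w → z ≼ w × z ↦ w) where

  private
    Link : Set (a ⊔ ℓ ⊔ ℓ′)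
    Link = Σ A λ y → Σ A λ z → y ≼ z × y ↦ z

    next : Link → Link
    next (_ , z , y≼z , y↦z) = let (w , z≼w , z↦w) = extend y≼z y↦z in z , w , z≼w , z↦w

    links : Link → ℕ → Link
    links l zero    = l
    links l (suc n) = next (links l n)

  path : ∀ {y z} → y ≼ z → y ↦ z → ℕ → A
  path y≼z y↦z n = proj₁ (links (_ , _ , y≼z , y↦z) n)

  path-step : ∀ {y z} (y≼z : y ≼ z) (y↦z : y ↦ z) n →
              let u = path y≼z y↦z in u n ≼ u (suc n) × u n ↦ u (suc n)
  path-step y≼z y↦z n = proj₂ (proj₂ (links (_ , _ , y≼z , y↦z) n))

module _ {c ℓ₁ ℓ₂ : Level} (P : Poset c ℓ₁ ℓ₂) where
  open Poset P

  ℕChain : (ℕ → Carrier) → Set ℓ₂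
  ℕChain u = (∀ {m n} → m ℕ.≤ n → u m ≤ u n) × (∀ {m n} → u m ≤ u n → m ℕ.≤ n)

  strictly-increasing⇒ℕChain : ∀ {u} → (∀ n → u n ≤ u (suc n)) → (∀ n → ¬ u (suc n) ≈ u n) →
                               ℕChain u
  strictly-increasing⇒ℕChain {u} u-step u-distinct = monotone ∘ ℕ.≤⇒≤′ , reflecting
    where
      monotone : ∀ {m n} → m ≤′ n → u m ≤ u n
      monotone ≤′-refl       = refl
      monotone (≤′-step m≤n) = trans (monotone m≤n) (u-step _)

      reflecting : ∀ {m n} → u m ≤ u n → m ℕ.≤ n
      reflecting {m} {n} um≤un with m ℕ.≤? n
      ... | yes m≤n = m≤n
      ... | no  m≰n = ⊥-elim (u-distinct n (antisym (trans (monotone (ℕ.≤⇒≤′ (ℕ.≰⇒> m≰n))) um≤un)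
                                                      (u-step n)))

module _ {c ℓ₁ ℓ₂ : Level} (P : Poset c ℓ₁ ℓ₂) where
  open Poset P

  RFPP⇒CFPP : RFPP P → CFPP P
  RFPP⇒CFPP rfpp f f-nonempty _ f-mono = rfpp f f-nonempty f-mono

  ℕChain-glue : ∀ {u d} → ℕChain P u → ℕChain (Flip.poset P) d → d 0 ≤ u 0 → ℤChain P
  ℕChain-glue {u} {d} (u-mono , u-reflect) (d-mono , d-reflect) d0≤u0 = g , g-mono , g-reflect
    where
      g : ℤ → Carrier
      g (+ n)    = u n
      g -[1+ n ] = d (suc n)

      g-mono : ∀ i j → i ℤ.≤ j → g i ≤ g j
      g-mono _ _ (ℤ.+≤+ m≤n)     = u-mono m≤n
      g-mono _ _ ℤ.-≤+           = trans (d-mono ℕ.z≤n) (trans d0≤u0 (u-mono ℕ.z≤n))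
      g-mono _ _ (ℤ.-≤- n≤m)     = d-mono (ℕ.s≤s n≤m)

      g-reflect : ∀ i j → g i ≤ g j → i ℤ.≤ j
      g-reflect (+ _)    (+ _)    um≤un = ℤ.+≤+ (u-reflect um≤un)
      g-reflect (+ _)    -[1+ _ ] um≤dn with d-reflect (trans d0≤u0 (trans (u-mono ℕ.z≤n) um≤dn))
      ... | ()
      g-reflect -[1+ _ ] (+ _)    _     = ℤ.-≤+
      g-reflect -[1+ _ ] -[1+ _ ] dm≤dn = ℤ.-≤- (ℕ.s≤s⁻¹ (d-reflect dm≤dn))

  ℤChain-injective : ((g , _) : ℤChain P) → ∀ {i j} → g i ≈ g j → i ≡ j
  ℤChain-injective (_ , _ , g-reflect) gi≈gj =
    ℤ.≤-antisym (g-reflect _ _ (reflexive gi≈gj)) (g-reflect _ _ (reflexive (Eq.sym gi≈gj)))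

  hull : Subset P → Subset P
  hull X = record
    { mem      = λ z → ∃ λ a → ∃ λ b → mem X a × mem X b × a ≤ z × z ≤ b
    ; respects = λ { z≈w (a , b , a∈X , b∈X , a≤z , z≤b) →
                     a , b , a∈X , b∈X , trans a≤z (reflexive z≈w) , trans (reflexive (Eq.sym z≈w)) z≤b }
    }

  ∈-hull : ∀ X {x} → mem X x → mem (hull X) x
  ∈-hull X x∈X = _ , _ , x∈X , x∈X , refl , refl

  hull-convex : ∀ X → Convex P (hull X)
  hull-convex X (a , _ , a∈X , _ , a≤x , _) (_ , b , _ , b∈X , _ , z≤b) x≤y y≤z =
    a , b , a∈X , b∈X , trans a≤x x≤y , trans y≤z z≤b

  hull-mono : ∀ {X Y} → _⊑_ P X Y → _⊑_ P (hull X) (hull Y)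
  hull-mono {X} {Y} (X-below-Y , Y-above-X) =
      (λ { z (_ , b , _ , b∈X , _ , z≤b) → let (b′ , b′∈Y , b≤b′) = X-below-Y b b∈X in
             b′ , ∈-hull Y b′∈Y , trans z≤b b≤b′ })
    , (λ { z (a , _ , a∈Y , _ , a≤z , _) → let (a′ , a′∈X , a′≤a) = Y-above-X a a∈Y in
             a′ , ∈-hull X a′∈X , trans a′≤a a≤z })

  module _ {f : Carrier → Subset P} (f-mono : ∀ {x y} → x ≤ y → _⊑_ P (f x) (f y))
           (fixed-point-free : ∀ x → ¬ mem (f x) x) where

    private
      _↦_ : Rel Carrier (lvl P)
      y ↦ z = mem (f y) z

      extend-up : ∀ {y z} → y ≤ z → y ↦ z → ∃ λ w → z ≤ w × z ↦ w
      extend-up y≤z y↦z = let (w , z↦w , z≤w) = proj₁ (f-mono y≤z) _ y↦z in w , z≤w , z↦w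

      extend-down : ∀ {y z} → z ≤ y → y ↦ z → ∃ λ w → w ≤ z × z ↦ w
      extend-down z≤y y↦z = let (w , z↦w , w≤z) = proj₂ (f-mono z≤y) _ y↦z in w , w≤z , z↦w

      ↦-distinct : ∀ {y z} → y ↦ z → ¬ z ≈ y
      ↦-distinct {y} y↦z z≈y = fixed-point-free y (respects (f y) z≈y y↦z)

    hull-fixed-point⇒ℤChain : ∀ {x a b} → a ≤ x → x ≤ b → x ↦ a → x ↦ b → ℤChain P
    hull-fixed-point⇒ℤChain a≤x x≤b x↦a x↦b = ℕChain-glue ascending descending refl
      where
        ascending : ℕChain P (path _≤_ _↦_ extend-up x≤b x↦b)
        ascending = strictly-increasing⇒ℕChain P
          (proj₁ ∘ path-step _≤_ _↦_ extend-up x≤b x↦b)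
          (↦-distinct ∘ proj₂ ∘ path-step _≤_ _↦_ extend-up x≤b x↦b)

        descending : ℕChain (Flip.poset P) (path (flip _≤_) _↦_ extend-down a≤x x↦a)
        descending = strictly-increasing⇒ℕChain (Flip.poset P)
          (proj₁ ∘ path-step (flip _≤_) _↦_ extend-down a≤x x↦a)
          (λ n → ↦-distinct (proj₂ (path-step (flip _≤_) _↦_ extend-down a≤x x↦a n)) ∘ Eq.sym)

  CFPP×¬ℤChain⇒RFPP : ExcludedMiddle (lvl P) → CFPP P → ¬ ℤChain P → RFPP P
  CFPP×¬ℤChain⇒RFPP em cfpp no-chain f f-nonempty f-mono with em {∃ λ x → mem (f x) x}
  ... | yes fixed   = fixed
  ... | no no-fixed
    with cfpp (hull ∘ f) (λ x → map₂ (∈-hull (f x)) (f-nonempty x)) (hull-convex ∘ f)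
              (λ {x} {y} x≤y → hull-mono {f x} {f y} (f-mono x≤y))
  ... | x , _ , _ , x↦a , x↦b , a≤x , x≤b =
    ⊥-elim (no-chain (hull-fixed-point⇒ℤChain {f} f-mono (λ y y↦y → no-fixed (y , y↦y)) a≤x x≤b x↦a x↦b))

  module _ (em : ExcludedMiddle (lvl P)) (ch : ℤChain P) where

    private
      g : ℤ → Carrier
      g = proj₁ ch

      g-mono : ∀ {i j} → i ℤ.≤ j → g i ≤ g j
      g-mono = proj₁ (proj₂ ch) _ _

      ≉-either : ∀ {y z} x → ¬ y ≈ z → ¬ y ≈ x ⊎ ¬ z ≈ x
      ≉-either {y} {z} x y≉z with map′ lower lift (em {Lift (c ⊔ ℓ₂) (y ≈ x)})
      ... | yes y≈x = inj₂ (λ z≈x → y≉z (Eq.trans y≈x (Eq.sym z≈x)))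
      ... | no  y≉x = inj₁ y≉x

      escape-up : ∀ i x → ∃ λ j → g i ≤ g j × ¬ g j ≈ x
      escape-up i x = [ (λ gi≉x → i , refl , gi≉x)
                      , (λ gsi≉x → ℤ.suc i , g-mono (ℤ.i≤suc[i] i) , gsi≉x) ]′
                        (≉-either x (ℤ.i≢suc[i] ∘ ℤChain-injective ch))

      escape-down : ∀ i x → ∃ λ j → g j ≤ g i × ¬ g j ≈ x
      escape-down i x = [ (λ gi≉x → i , refl , gi≉x)
                        , (λ gpi≉x → ℤ.pred i , g-mono pred≤ , gpi≉x) ]′
                          (≉-either x (pred≢ ∘ ≡.sym ∘ ℤChain-injective ch))
        where
          pred≤ : ℤ.pred i ℤ.≤ i
          pred≤ = ℤ.i≤j⇒pred[i]≤j ℤ.≤-refl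

          pred≢ : ℤ.pred i ≢ i
          pred≢ pi≡i = ℤ.i≢suc[i] (≡.trans pi≡i (≡.sym (ℤ.suc-pred i)))

    chain-avoiding : Carrier → Subset P
    chain-avoiding x = record
      { mem      = λ z → ∃ λ i → Lift (c ⊔ ℓ₂) (z ≈ g i × ¬ g i ≈ x)
      ; respects = λ { z≈w (i , lift (z≈gi , gi≉x)) → i , lift (Eq.trans (Eq.sym z≈w) z≈gi , gi≉x) }
      }

    chain-avoiding-nonempty : ∀ x → Nonempty P (chain-avoiding x)
    chain-avoiding-nonempty x = let (j , _ , gj≉x) = escape-up (+ 0) x in g j , j , lift (Eq.refl , gj≉x)

    chain-avoiding-mono : ∀ {x y} → x ≤ y → _⊑_ P (chain-avoiding x) (chain-avoiding y)
    chain-avoiding-mono {x} {y} _ =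
        (λ { z (i , lift (z≈gi , _)) → let (j , gi≤gj , gj≉y) = escape-up i y in
               g j , (j , lift (Eq.refl , gj≉y)) , trans (reflexive z≈gi) gi≤gj })
      , (λ { z (i , lift (z≈gi , _)) → let (j , gj≤gi , gj≉x) = escape-down i x in
               g j , (j , lift (Eq.refl , gj≉x)) , trans gj≤gi (reflexive (Eq.sym z≈gi)) })

    chain-avoiding-fixed-point-free : ∀ x → ¬ mem (chain-avoiding x) x
    chain-avoiding-fixed-point-free x (_ , lift (x≈gi , gi≉x)) = gi≉x (Eq.sym x≈gi)

  RFPP⇒¬ℤChain : ExcludedMiddle (lvl P) → RFPP P → ¬ ℤChain P
  RFPP⇒¬ℤChain em rfpp ch =
    let (x , x∈fx) = rfpp (chain-avoiding em ch) (chain-avoiding-nonempty em ch) (chain-avoiding-mono em ch)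
    in chain-avoiding-fixed-point-free em ch x x∈fx

  Finite⇒¬injective : Finite P → (u : ℕ → Carrier) → ¬ (∀ {m n} → u m ≈ u n → m ≡ n)
  Finite⇒¬injective (n , e , covers) u u-injective
    with pigeonhole (ℕ.n<1+n n) (proj₁ ∘ covers ∘ u ∘ toℕ)
  ... | i , j , i<j , same-index = ℕ.<-irrefl (u-injective ui≈uj) i<j
    where
      ui≈uj : u (toℕ i) ≈ u (toℕ j)
      ui≈uj = Eq.trans (Eq.sym (proj₂ (covers (u (toℕ i)))))
                (Eq.trans (Eq.reflexive (≡.cong e same-index)) (proj₂ (covers (u (toℕ j)))))

  Finite⇒¬ℤChain : Finite P → ¬ ℤChain P
  Finite⇒¬ℤChain fin ch = Finite⇒¬injective fin (proj₁ ch ∘ +_) (ℤ.+-injective ∘ ℤChain-injective ch)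

theorem3 : ∀ {c ℓ₁ ℓ₂ : Level} → ExcludedMiddle (c ⊔ ℓ₁ ⊔ ℓ₂) → (P : Poset c ℓ₁ ℓ₂)
    → (RFPP P ⇔ (CFPP P × ¬ ℤChain P))
      × (Finite P → (RFPP P ⇔ CFPP P))
theorem3 em P =
    mk⇔ (λ rfpp → RFPP⇒CFPP P rfpp , RFPP⇒¬ℤChain P em rfpp) (uncurry (CFPP×¬ℤChain⇒RFPP P em))
  , λ fin → mk⇔ (RFPP⇒CFPP P) (λ cfpp → CFPP×¬ℤChain⇒RFPP P em cfpp (Finite⇒¬ℤChain P fin))
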